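{- Let $I_1,I_2$ be interval-posets of sizes $n>0$ and $m>0$. Then $\mathrm{ic}_\infty(I_1\prec I_2)=\mathrm{ic}_\infty(I_2)$ and $\mathrm{IC}(I_1\prec I_2)=(\mathrm{ic}_\infty(I_2),\mathrm{ic}_m(I_2),\dots,\mathrm{ic}_2(I_2),\mathrm{ic}_\infty(I_1),\mathrm{ic}_n(I_1),\dots,\mathrm{ic}_2(I_1))$; and for every admissible $i$, $\mathrm{ic}_\infty(I_1\succ_i I_2)=\mathrm{ic}_\infty(I_2)+\mathrm{ic}_\infty(I_1)$ and $\mathrm{IC}(I_1\succ_i I_2)=(\mathrm{ic}_\infty(I_2)+\mathrm{ic}_\infty(I_1),\mathrm{ic}_m(I_2),\dots,\mathrm{ic}_2(I_2),0,\mathrm{ic}_n(I_1),\dots,\mathrm{ic}_2(I_1))$. If $\mathrm{size}(I_1)=0$ then $I_1\prec I_2=I_2$ and $\mathrm{IC}(I_1\prec I_2)=\mathrm{IC}(I_2)$; if $\mathrm{size}(I_2)=0$ then $I_1\succ_i I_2=I_1$ and $\mathrm{IC}(I_1\succ_i I_2)=\mathrm{IC}(I_1)$.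
   Context: An interval-poset of size $n$ is a partial order $\triangleleft$ on $\{1,\dots,n\}$ with $a\triangleleft c\Rightarrow b\triangleleft c$ and $c\triangleleft a\Rightarrow b\triangleleft a$ for all $a<b<c$. A relation $x\triangleleft y$ is increasing if $x<y$; the initial forest is the poset of increasing relations. A vertex $b$ is an increasing root if there is no $c>b$ with $b\triangleleft c$. The increasing children of $b$ are the $a<b$ with $a\triangleleft b$ a cover relation of the initial forest. $\mathrm{ic}_\infty(I)$ is the number of increasing roots, $\mathrm{ic}_b(I)$ the number of increasing children of $b$, and $\mathrm{IC}(I)=(\mathrm{ic}_\infty(I),\mathrm{ic}_n(I),\mathrm{ic}_{n-1}(I),\dots,\mathrm{ic}_2(I))$. Grafting: for interval-posets $I_1,I_2$ of sizes $n_1,n_2$, the shifted concatenation has the relations of $I_1$ and of $I_2$ shifted by $n_1$. For $n_2>0$, $I_1\prec I_2$ adds the relations $y\triangleleft n_1+1$ for all $y\le n_1$. For $n_1>0$ and $0\le r\le c$, with $y_1<\dots<y_c$ the decreasing roots of $I_2$ (vertices $b$ with no $a<b$ such that $b\triangleleft a$) shifted by $n_1$, $I_1\succ_r I_2$ adds the relations $y_i\triangleleft n_1$ for $1\le i\le r$. "Admissible $i$" means $0\le i\le c$. -}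

module Defs where

open import Data.Nat using (ℕ; zero; suc; _+_; _∸_; _≤_; _<_; _≡ᵇ_; _<ᵇ_; _≤ᵇ_)
open import Data.Bool using (Bool; true; false; _∧_; _∨_; not; if_then_else_)
open import Data.List using (List; []; _∷_; applyUpTo; map; take; length)
open import Data.Bool.ListAction using (any)
open import Data.Product using (_×_)
open import Relation.Binary.PropositionalEquality using (_≡_)

-- A (raw) relation on {1,…,n} is encoded as a Boolean function on ℕ;
-- rel x y ≡ true means x ◁ y.
BRel : Set
BRel = ℕ → ℕ → Bool

from+ : ℕ → ℕ → List ℕ
from+ a k = applyUpTo (λ i → suc (a + i)) k

range1 : ℕ → List ℕ
range1 N = from+ 0 N

countB : (ℕ → Bool) → List ℕ → ℕ
countB p []       = 0
countB p (x ∷ xs) = if p x then suc (countB p xs) else countB p xs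

down2 : ℕ → List ℕ
down2 zero          = []
down2 (suc zero)    = []
down2 (suc (suc k)) = suc (suc k) ∷ down2 (suc k)

record IntervalPoset (n : ℕ) : Set where
  field
    rel      : BRel
    support  : ∀ x y → rel x y ≡ true → (1 ≤ x) × (x ≤ n) × (1 ≤ y) × (y ≤ n)
    reflex   : ∀ x → 1 ≤ x → x ≤ n → rel x x ≡ true
    antisym  : ∀ x y → rel x y ≡ true → rel y x ≡ true → x ≡ y
    trans    : ∀ x y z → rel x y ≡ true → rel y z ≡ true → rel x z ≡ true
    interval₁ : ∀ a b c → a < b → b < c → rel a c ≡ true → rel b c ≡ true
    interval₂ : ∀ a b c → a < b → b < c → rel c a ≡ true → rel b a ≡ true
open IntervalPoset public

isIncRoot : ℕ → BRel → ℕ → Bool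
isIncRoot n R b = not (any (λ c → R b c) (from+ b (n ∸ b)))

icInfR : ℕ → BRel → ℕ
icInfR n R = countB (isIncRoot n R) (range1 n)

-- a is an increasing child of b: a < b, a ◁ b, and this is a cover relation
-- of the initial forest (no c with a < c < b, a ◁ c, c ◁ b)
isIncChild : BRel → ℕ → ℕ → Bool
isIncChild R b a = R a b ∧ not (any (λ c → R a c ∧ R c b) (from+ a (b ∸ suc a)))

icR : BRel → ℕ → ℕ
icR R b = countB (isIncChild R b) (range1 (b ∸ 1))

icDownR : ℕ → BRel → List ℕ
icDownR n R = map (icR R) (down2 n)

ICR : ℕ → BRel → List ℕ
ICR n R = icInfR n R ∷ icDownR n R

icInf : ∀ {n} → IntervalPoset n → ℕ
icInf {n} I = icInfR n (rel I)

icDown : ∀ {n} → IntervalPoset n → List ℕ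
icDown {n} I = icDownR n (rel I)

IC : ∀ {n} → IntervalPoset n → List ℕ
IC {n} I = ICR n (rel I)

closeStep : ℕ → BRel → BRel
closeStep N R x y = R x y ∨ any (λ z → R x z ∧ R z y) (range1 N)

closeIter : ℕ → ℕ → BRel → BRel
closeIter N zero    R = R
closeIter N (suc k) R = closeStep N (closeIter N k R)

-- after N squaring-steps all paths of length ≤ 2^N are captured
transClosure : ℕ → BRel → BRel
transClosure N R = closeIter N N R

shiftConcat : ∀ {n m} → IntervalPoset n → IntervalPoset m → BRel
shiftConcat {n} {m} I₁ I₂ x y =
  rel I₁ x y ∨ ((n <ᵇ x) ∧ (n <ᵇ y) ∧ rel I₂ (x ∸ n) (y ∸ n))

graftL : ∀ {n m} → IntervalPoset n → IntervalPoset m → BRel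
graftL {n} {m} I₁ I₂ = transClosure (n + m) base
  where
  base : BRel
  base x y = shiftConcat I₁ I₂ x y
           ∨ ((0 <ᵇ m) ∧ (1 ≤ᵇ x) ∧ (x ≤ᵇ n) ∧ (y ≡ᵇ suc n))

isDecRoot : BRel → ℕ → Bool
isDecRoot R b = not (any (λ a → R b a) (range1 (b ∸ 1)))

filterB : (ℕ → Bool) → List ℕ → List ℕ
filterB p []       = []
filterB p (x ∷ xs) = if p x then x ∷ filterB p xs else filterB p xs

decRoots : ∀ {m} → IntervalPoset m → List ℕ
decRoots {m} I = filterB (isDecRoot (rel I)) (range1 m)

memB : ℕ → List ℕ → Bool
memB x xs = any (λ z → z ≡ᵇ x) xs

graftR : ∀ {n m} → IntervalPoset n → ℕ → IntervalPoset m → BRel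
graftR {n} {m} I₁ r I₂ = transClosure (n + m) base
  where
  base : BRel
  base x y = shiftConcat I₁ I₂ x y
           ∨ ((0 <ᵇ n) ∧ memB x (take r (map (n +_) (decRoots I₂))) ∧ (y ≡ᵇ n))

module Submission where

-- Both grafts are transitive closures of the shifted concatenation SC of I₁ and
-- I₂ plus some pairs crossing between the lower block {1,…,n} and the upper block
-- {n+1,…,n+m}.  By closure induction every related pair of a graft falls into an
-- explicit transitive "view" (inside I₁, inside the translate of I₂, or a crossing
-- pair of a known shape), so the graft restricts to I₁ and to I₂ on the two blocks
-- (Graft.Restriction).  The statistics are local (they only read increasing
-- relations inside an interval) and invariant under translation, so for such a
-- relation IC is assembled from IC(I₂), IC(I₁), the number of increasing roots in
-- the lower block, and the number of children of the junction vertex n+1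
-- (Decomposition).  In I₁ ≺ I₂ every lower vertex lies below n+1: no lower vertex
-- is a root and the children of n+1 are the roots of I₁.  In I₁ ≻_r I₂ nothing of
-- the lower block lies below the upper block: the lower roots are those of I₁ and
-- n+1 has no children.  When one side is empty the views identify the graft with
-- the other poset.

open import Defs
open import Data.Nat using (ℕ; zero; suc; _+_; _∸_; _≤_; _<_; z≤n; s≤s; _≤ᵇ_; _<ᵇ_; _≡ᵇ_)
open import Data.Nat.Properties
open import Data.Bool using (Bool; true; false; _∧_; _∨_; not; T)
open import Data.Bool.Properties using (∨-assoc; ∨-identityʳ; ∧-identityʳ; ∧-zeroʳ; T-≡; ¬-not)
open import Data.Bool.ListAction using (any)
open import Data.List using ([]; _∷_; _++_; map; applyUpTo; take; length)
open import Data.List.Properties using (map-applyUpTo; map-cong-local; map-++; map-∘)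
open import Data.List.Relation.Unary.All as All using (All; []; _∷_)
open import Data.List.Relation.Unary.All.Properties using (applyUpTo⁺₁; map⁺; take⁺)
import Data.List.Relation.Unary.Any.Properties as Any
open import Data.Product using (_×_; _,_; Σ; proj₁; proj₂)
open import Data.Sum using (_⊎_; inj₁; inj₂)
open import Data.Empty using (⊥; ⊥-elim)
open import Function using (_∘_; Equivalence)
open import Relation.Binary.PropositionalEquality
  using (_≡_; refl; sym; cong; cong₂; subst; module ≡-Reasoning)
  renaming (trans to ≡-trans)

∨-elim : ∀ a {b} → a ∨ b ≡ true → a ≡ true ⊎ b ≡ true
∨-elim true  _ = inj₁ refl
∨-elim false e = inj₂ e

∨-introˡ : ∀ {a} b → a ≡ true → a ∨ b ≡ true
∨-introˡ _ refl = refl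

∨-introʳ : ∀ a {b} → b ≡ true → a ∨ b ≡ true
∨-introʳ true  _ = refl
∨-introʳ false e = e

∧-elim : ∀ a {b} → a ∧ b ≡ true → a ≡ true × b ≡ true
∧-elim true e = refl , e

∧-intro : ∀ {a b} → a ≡ true → b ≡ true → a ∧ b ≡ true
∧-intro refl refl = refl

≡true-ext : ∀ {a b} → (a ≡ true → b ≡ true) → (b ≡ true → a ≡ true) → a ≡ b
≡true-ext {false} {false} _ _ = refl
≡true-ext {false} {true}  _ g = g refl
≡true-ext {true}  {false} f _ = sym (f refl)
≡true-ext {true}  {true}  _ _ = refl

fromT : ∀ {b} → T b → b ≡ true
fromT = Equivalence.to T-≡

toT : ∀ {b} → b ≡ true → T b
toT = Equivalence.from T-≡

any-witness : ∀ (p : ℕ → Bool) xs → any p xs ≡ true → Σ ℕ (λ z → p z ≡ true)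
any-witness p (x ∷ xs) e with ∨-elim (p x) e
... | inj₁ px = x , px
... | inj₂ rest = any-witness p xs rest

any-cong : ∀ {p q : ℕ → Bool} {xs} → All (λ x → p x ≡ q x) xs → any p xs ≡ any q xs
any-cong []       = refl
any-cong (e ∷ es) = cong₂ _∨_ e (any-cong es)

any-false : ∀ {p : ℕ → Bool} {xs} → All (λ x → p x ≡ false) xs → any p xs ≡ false
any-false []       = refl
any-false (e ∷ es) rewrite e = any-false es

any-++ : ∀ (p : ℕ → Bool) xs ys → any p (xs ++ ys) ≡ any p xs ∨ any p ys
any-++ p []       ys = refl
any-++ p (x ∷ xs) ys = ≡-trans (cong (p x ∨_) (any-++ p xs ys)) (sym (∨-assoc (p x) _ _))

any-map : ∀ (p : ℕ → Bool) (f : ℕ → ℕ) xs → any p (map f xs) ≡ any (p ∘ f) xs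
any-map p f []       = refl
any-map p f (x ∷ xs) = cong (p (f x) ∨_) (any-map p f xs)

countB-cong : ∀ {p q : ℕ → Bool} {xs} → All (λ x → p x ≡ q x) xs → countB p xs ≡ countB q xs
countB-cong []                          = refl
countB-cong {xs = x ∷ _} (e ∷ es) rewrite e | countB-cong es = refl

countB-false : ∀ {p : ℕ → Bool} {xs} → All (λ x → p x ≡ false) xs → countB p xs ≡ 0
countB-false []       = refl
countB-false (e ∷ es) rewrite e = countB-false es

countB-++ : ∀ (p : ℕ → Bool) xs ys → countB p (xs ++ ys) ≡ countB p xs + countB p ys
countB-++ p []       ys = refl
countB-++ p (x ∷ xs) ys with p x
... | true  = cong suc (countB-++ p xs ys)
... | false = countB-++ p xs ys

countB-map : ∀ (p : ℕ → Bool) (f : ℕ → ℕ) xs → countB p (map f xs) ≡ countB (p ∘ f) xs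
countB-map p f []       = refl
countB-map p f (x ∷ xs) with p (f x)
... | true  = cong suc (countB-map p f xs)
... | false = countB-map p f xs

applyUpTo-cong : ∀ {f g : ℕ → ℕ} k → (∀ i → f i ≡ g i) → applyUpTo f k ≡ applyUpTo g k
applyUpTo-cong zero    f≗g = refl
applyUpTo-cong (suc k) f≗g = cong₂ _∷_ (f≗g 0) (applyUpTo-cong k (f≗g ∘ suc))

from+-All : ∀ {P : ℕ → Set} a k → (∀ x → a < x → x ≤ a + k → P x) → All P (from+ a k)
from+-All a k h = applyUpTo⁺₁ _ k (λ {i} i<k → h _ (s≤s (m≤m+n a i)) (+-monoʳ-< a i<k))

from+-∸-All : ∀ {P : ℕ → Set} a N → (∀ x → a < x → x ≤ N → P x) → All P (from+ a (N ∸ a))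
from+-∸-All a N h with ≤-total a N
... | inj₁ a≤N = from+-All a (N ∸ a) (λ x a<x x≤ → h x a<x (subst (x ≤_) (m+[n∸m]≡n a≤N) x≤))
... | inj₂ N≤a rewrite m≤n⇒m∸n≡0 N≤a = []

range1-All : ∀ {P : ℕ → Set} N → (∀ x → 1 ≤ x → x ≤ N → P x) → All P (range1 N)
range1-All = from+-All 0

from+-any : ∀ (p : ℕ → Bool) a k x → a < x → x ≤ a + k → p x ≡ true → any p (from+ a k) ≡ true
from+-any p a k (suc x) (s≤s a≤x) x≤a+k px =
  fromT (Any.any⁺ p (Any.applyUpTo⁺ _ (toT (subst (λ v → p v ≡ true) (sym position) px)) i<k))
  where
  position : suc (a + (x ∸ a)) ≡ suc x
  position = cong suc (m+[n∸m]≡n a≤x)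
  i<k : x ∸ a < k
  i<k = +-cancelˡ-< a (x ∸ a) k (subst (_≤ a + k) (sym position) x≤a+k)

from+-∸-any : ∀ (p : ℕ → Bool) a N x → a < x → x ≤ N → p x ≡ true → any p (from+ a (N ∸ a)) ≡ true
from+-∸-any p a N x a<x x≤N =
  from+-any p a (N ∸ a) x a<x (subst (x ≤_) (sym (m+[n∸m]≡n (<⇒≤ (<-≤-trans a<x x≤N)))) x≤N)

from+-suc : ∀ a k → from+ a (suc k) ≡ suc a ∷ from+ (suc a) k
from+-suc a k = cong₂ _∷_ (cong suc (+-identityʳ a)) (applyUpTo-cong k (λ i → cong suc (+-suc a i)))

from+-split : ∀ a k l → from+ a (k + l) ≡ from+ a k ++ from+ (a + k) l
from+-split a zero    l = cong (λ b → from+ b l) (sym (+-identityʳ a))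
from+-split a (suc k) l = begin
  from+ a (suc k + l)                       ≡⟨ from+-suc a (k + l) ⟩
  suc a ∷ from+ (suc a) (k + l)             ≡⟨ cong (suc a ∷_) (from+-split (suc a) k l) ⟩
  suc a ∷ from+ (suc a) k ++ from+ (suc a + k) l
    ≡⟨ cong₂ (λ xs b → suc a ∷ xs ++ from+ b l) refl (sym (+-suc a k)) ⟩
  suc a ∷ from+ (suc a) k ++ from+ (a + suc k) l
    ≡⟨ cong (_++ from+ (a + suc k) l) (sym (from+-suc a k)) ⟩
  from+ a (suc k) ++ from+ (a + suc k) l    ∎
  where open ≡-Reasoning

from+-shift : ∀ n a k → from+ (n + a) k ≡ map (n +_) (from+ a k)
from+-shift n a k = ≡-trans
  (applyUpTo-cong k (λ i → ≡-trans (cong suc (+-assoc n a i)) (sym (+-suc n (a + i)))))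
  (sym (map-applyUpTo _ (n +_) k))

range1-split : ∀ n m → range1 (n + m) ≡ range1 n ++ map (n +_) (range1 m)
range1-split n m = ≡-trans (from+-split 0 n m)
  (cong (range1 n ++_) (≡-trans (cong (λ b → from+ b m) (sym (+-identityʳ n))) (from+-shift n 0 m)))

down2-step : ∀ j → 1 ≤ j → down2 (suc j) ≡ suc j ∷ down2 j
down2-step (suc j) _ = refl

down2-split : ∀ n k → 1 ≤ n → down2 (n + suc k) ≡ map (n +_) (down2 (suc k)) ++ down2 (suc n)
down2-split n zero    1≤n = cong down2 (+-comm n 1)
down2-split n (suc k) 1≤n = begin
  down2 (n + suc (suc k))                        ≡⟨ cong down2 (+-suc n (suc k)) ⟩
  down2 (suc (n + suc k))                        ≡⟨ down2-step (n + suc k) (≤-trans 1≤n (m≤m+n n _)) ⟩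
  suc (n + suc k) ∷ down2 (n + suc k)            ≡⟨ cong₂ _∷_ (sym (+-suc n (suc k))) (down2-split n k 1≤n) ⟩
  map (n +_) (down2 (suc (suc k))) ++ down2 (suc n) ∎
  where open ≡-Reasoning

down2-bounds : ∀ k → All (λ b → 2 ≤ b × b ≤ k) (down2 k)
down2-bounds zero          = []
down2-bounds (suc zero)    = []
down2-bounds (suc (suc k)) =
  (s≤s (s≤s z≤n) , ≤-refl) ∷ All.map (λ { (2≤b , b≤) → 2≤b , m≤n⇒m≤1+n b≤ }) (down2-bounds (suc k))

closeIter-base : ∀ N k R x y → R x y ≡ true → closeIter N k R x y ≡ true
closeIter-base N zero    R x y e = e
closeIter-base N (suc k) R x y e = ∨-introˡ _ (closeIter-base N k R x y e)

closure-base : ∀ N R x y → R x y ≡ true → transClosure N R x y ≡ true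
closure-base N = closeIter-base N N

closure-induction : ∀ N R (P : ℕ → ℕ → Set) →
  (∀ x y → R x y ≡ true → P x y) → (∀ {x y z} → P x y → P y z → P x z) →
  ∀ x y → transClosure N R x y ≡ true → P x y
closure-induction N R P base trans-P = iterate N
  where
  iterate : ∀ k x y → closeIter N k R x y ≡ true → P x y
  iterate zero    x y e = base x y e
  iterate (suc k) x y e with ∨-elim (closeIter N k R x y) e
  ... | inj₁ direct = iterate k x y direct
  ... | inj₂ composite with any-witness _ (range1 N) composite
  ... | z , xzy with ∧-elim (closeIter N k R x z) xzy
  ... | xz , zy = trans-P (iterate k x z xz) (iterate k z y zy)

shiftRel : ℕ → BRel → BRel
shiftRel n R x y = R (n + x) (n + y)

AgreeOn : ℕ → ℕ → BRel → BRel → Set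
AgreeOn lo hi R S = ∀ x y → lo ≤ x → x < y → y ≤ hi → R x y ≡ S x y

AgreeOn-narrow : ∀ {lo hi lo′ hi′ R S} → lo ≤ lo′ → hi′ ≤ hi → AgreeOn lo hi R S → AgreeOn lo′ hi′ R S
AgreeOn-narrow lo≤lo′ hi′≤hi agree x y lo′≤x x<y y≤hi′ =
  agree x y (≤-trans lo≤lo′ lo′≤x) x<y (≤-trans y≤hi′ hi′≤hi)

isIncRoot-shift : ∀ n m R b → isIncRoot (n + m) R (n + b) ≡ isIncRoot m (shiftRel n R) b
isIncRoot-shift n m R b = cong not (begin
  any (R (n + b)) (from+ (n + b) (n + m ∸ (n + b)))
    ≡⟨ cong (λ k → any (R (n + b)) (from+ (n + b) k)) ([m+n]∸[m+o]≡n∸o n m b) ⟩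
  any (R (n + b)) (from+ (n + b) (m ∸ b))          ≡⟨ cong (any (R (n + b))) (from+-shift n b (m ∸ b)) ⟩
  any (R (n + b)) (map (n +_) (from+ b (m ∸ b)))   ≡⟨ any-map (R (n + b)) (n +_) (from+ b (m ∸ b)) ⟩
  any (shiftRel n R b) (from+ b (m ∸ b))           ∎)
  where open ≡-Reasoning

isIncChild-shift : ∀ n R a b → isIncChild R (n + b) (n + a) ≡ isIncChild (shiftRel n R) b a
isIncChild-shift n R a b = cong (R (n + a) (n + b) ∧_) (cong not (begin
  any between (from+ (n + a) (n + b ∸ suc (n + a))) ≡⟨ cong (λ k → any between (from+ (n + a) k)) gap ⟩
  any between (from+ (n + a) (b ∸ suc a))           ≡⟨ cong (any between) (from+-shift n a (b ∸ suc a)) ⟩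
  any between (map (n +_) (from+ a (b ∸ suc a)))    ≡⟨ any-map between (n +_) (from+ a (b ∸ suc a)) ⟩
  any (λ c → shiftRel n R a c ∧ shiftRel n R c b) (from+ a (b ∸ suc a)) ∎))
  where
  open ≡-Reasoning
  between : ℕ → Bool
  between c = R (n + a) c ∧ R c (n + b)
  gap : n + b ∸ suc (n + a) ≡ b ∸ suc a
  gap = ≡-trans (cong (n + b ∸_) (sym (+-suc n a))) ([m+n]∸[m+o]≡n∸o n b (suc a))

isIncRoot-local : ∀ N R S b → AgreeOn b N R S → isIncRoot N R b ≡ isIncRoot N S b
isIncRoot-local N R S b agree =
  cong not (any-cong (from+-∸-All b N (λ c b<c c≤N → agree b c ≤-refl b<c c≤N)))

isIncChild-local : ∀ R S a b → a < b → AgreeOn a b R S → isIncChild R b a ≡ isIncChild S b a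
isIncChild-local R S a (suc b) a<b agree = cong₂ _∧_ (agree a (suc b) ≤-refl a<b ≤-refl)
  (cong not (any-cong (from+-∸-All a b (λ c a<c c≤b →
    cong₂ _∧_ (agree a c ≤-refl a<c (m≤n⇒m≤1+n c≤b)) (agree c (suc b) (<⇒≤ a<c) (s≤s c≤b) ≤-refl)))))

icR-local : ∀ R S b → AgreeOn 1 b R S → icR R b ≡ icR S b
icR-local R S zero    agree = refl
icR-local R S (suc b) agree = countB-cong (range1-All b (λ a 1≤a a≤b →
  isIncChild-local R S a (suc b) (s≤s a≤b) (AgreeOn-narrow 1≤a ≤-refl agree)))

icInfR-local : ∀ N R S → AgreeOn 1 N R S → icInfR N R ≡ icInfR N S
icInfR-local N R S agree = countB-cong (range1-All N (λ b 1≤b _ →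
  isIncRoot-local N R S b (AgreeOn-narrow 1≤b ≤-refl agree)))

icDownR-local : ∀ N R S → AgreeOn 1 N R S → icDownR N R ≡ icDownR N S
icDownR-local N R S agree = map-cong-local
  (All.map (λ {b} (_ , b≤N) → icR-local R S b (AgreeOn-narrow ≤-refl b≤N agree)) (down2-bounds N))

ICR-local : ∀ N R S → AgreeOn 1 N R S → ICR N R ≡ ICR N S
ICR-local N R S agree = cong₂ _∷_ (icInfR-local N R S agree) (icDownR-local N R S agree)

countB-range1-split : ∀ p n k → countB p (range1 (n + k)) ≡ countB p (range1 n) + countB (p ∘ (n +_)) (range1 k)
countB-range1-split p n k = begin
  countB p (range1 (n + k))                            ≡⟨ cong (countB p) (range1-split n k) ⟩
  countB p (range1 n ++ map (n +_) (range1 k))         ≡⟨ countB-++ p (range1 n) _ ⟩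
  countB p (range1 n) + countB p (map (n +_) (range1 k)) ≡⟨ cong (countB p (range1 n) +_) (countB-map p (n +_) (range1 k)) ⟩
  countB p (range1 n) + countB (p ∘ (n +_)) (range1 k) ∎
  where open ≡-Reasoning

icInfR-split : ∀ n m R → icInfR (n + m) R ≡ countB (isIncRoot (n + m) R) (range1 n) + icInfR m (shiftRel n R)
icInfR-split n m R = ≡-trans (countB-range1-split (isIncRoot (n + m) R) n m)
  (cong (countB (isIncRoot (n + m) R) (range1 n) +_) (countB-cong (All.universal (isIncRoot-shift n m R) (range1 m))))

icR-split : ∀ n R b → 1 ≤ b → icR R (n + b) ≡ countB (isIncChild R (n + b)) (range1 n) + icR (shiftRel n R) b
icR-split n R (suc b) _ = begin
  icR R (n + suc b)                                 ≡⟨ cong (λ k → countB child (range1 (k ∸ 1))) (+-suc n b) ⟩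
  countB child (range1 (n + b))                     ≡⟨ countB-range1-split child n b ⟩
  countB child (range1 n) + countB (child ∘ (n +_)) (range1 b)
    ≡⟨ cong (countB child (range1 n) +_) (countB-cong (All.universal (λ a → isIncChild-shift n R a (suc b)) (range1 b))) ⟩
  countB child (range1 n) + icR (shiftRel n R) (suc b) ∎
  where
  open ≡-Reasoning
  child : ℕ → Bool
  child = isIncChild R (n + suc b)

icDownR-split : ∀ n m R → 1 ≤ n → 1 ≤ m →
  icDownR (n + m) R ≡ map (λ b → icR R (n + b)) (down2 m) ++ icR R (suc n) ∷ icDownR n R
icDownR-split n (suc k) R 1≤n _ = begin
  map (icR R) (down2 (n + suc k))                          ≡⟨ cong (map (icR R)) (down2-split n k 1≤n) ⟩
  map (icR R) (map (n +_) (down2 (suc k)) ++ down2 (suc n)) ≡⟨ map-++ (icR R) _ (down2 (suc n)) ⟩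
  map (icR R) (map (n +_) (down2 (suc k))) ++ map (icR R) (down2 (suc n))
    ≡⟨ cong₂ _++_ (sym (map-∘ (down2 (suc k)))) (cong (map (icR R)) (down2-step n 1≤n)) ⟩
  map (icR R ∘ (n +_)) (down2 (suc k)) ++ icR R (suc n) ∷ map (icR R) (down2 n) ∎
  where open ≡-Reasoning

isIncRoot-extend : ∀ n m R b → b ≤ n → (∀ c → n < c → R b c ≡ false) → isIncRoot (n + m) R b ≡ isIncRoot n R b
isIncRoot-extend n m R b b≤n isolated = cong not (begin
  any (R b) (from+ b (n + m ∸ b))                              ≡⟨ cong (λ k → any (R b) (from+ b k)) (+-∸-comm m b≤n) ⟩
  any (R b) (from+ b (n ∸ b + m))                              ≡⟨ cong (any (R b)) (from+-split b (n ∸ b) m) ⟩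
  any (R b) (from+ b (n ∸ b) ++ from+ (b + (n ∸ b)) m)          ≡⟨ any-++ (R b) (from+ b (n ∸ b)) _ ⟩
  any (R b) (from+ b (n ∸ b)) ∨ any (R b) (from+ (b + (n ∸ b)) m) ≡⟨ cong (any (R b) (from+ b (n ∸ b)) ∨_) right-of-n ⟩
  any (R b) (from+ b (n ∸ b)) ∨ false                            ≡⟨ ∨-identityʳ _ ⟩
  any (R b) (from+ b (n ∸ b))                                  ∎)
  where
  open ≡-Reasoning
  right-of-n : any (R b) (from+ (b + (n ∸ b)) m) ≡ false
  right-of-n = any-false (from+-All _ m (λ c lt _ → isolated c (subst (_< c) (m+[n∸m]≡n b≤n) lt)))

not-cover : ∀ R a c b → a < c → c < b → R a c ≡ true → R c b ≡ true → isIncChild R b a ≡ false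
not-cover R a c (suc b) a<c (s≤s c≤b) ac cb =
  ≡-trans (cong (λ t → R a (suc b) ∧ not t) (from+-∸-any (λ w → R a w ∧ R w (suc b)) a b c a<c c≤b (∧-intro ac cb)))
          (∧-zeroʳ (R a (suc b)))

not-related-not-child : ∀ R a b → R a b ≡ false → isIncChild R b a ≡ false
not-related-not-child R a b a⋪b rewrite a⋪b = refl

not-child-unless-related : ∀ R a b → (R a b ≡ true → isIncChild R b a ≡ false) → isIncChild R b a ≡ false
not-child-unless-related R a b h with R a b
... | false = refl
... | true  = h refl

module Decomposition {n m} (I₁ : IntervalPoset n) (I₂ : IntervalPoset m) (R : BRel)
  (lowAgree : AgreeOn 1 n R (rel I₁))
  (highAgree : AgreeOn 1 m (shiftRel n R) (rel I₂))
  (noCrossChild : ∀ a b → 1 ≤ a → a ≤ n → 2 ≤ b → b ≤ m → isIncChild R (n + b) a ≡ false) where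

  lowerRoots : ℕ
  lowerRoots = countB (isIncRoot (n + m) R) (range1 n)

  icInf-decomposition : icInfR (n + m) R ≡ lowerRoots + icInf I₂
  icInf-decomposition =
    ≡-trans (icInfR-split n m R) (cong (lowerRoots +_) (icInfR-local m (shiftRel n R) (rel I₂) highAgree))

  upper-ic : ∀ b → 2 ≤ b → b ≤ m → icR R (n + b) ≡ icR (rel I₂) b
  upper-ic b 2≤b b≤m = begin
    icR R (n + b)                                                    ≡⟨ icR-split n R b (≤-trans (s≤s z≤n) 2≤b) ⟩
    countB (isIncChild R (n + b)) (range1 n) + icR (shiftRel n R) b ≡⟨ cong₂ _+_ no-lower-children upper-children ⟩
    icR (rel I₂) b                                                   ∎
    where
    open ≡-Reasoning
    no-lower-children : countB (isIncChild R (n + b)) (range1 n) ≡ 0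
    no-lower-children = countB-false (range1-All n (λ a 1≤a a≤n → noCrossChild a b 1≤a a≤n 2≤b b≤m))
    upper-children : icR (shiftRel n R) b ≡ icR (rel I₂) b
    upper-children = icR-local (shiftRel n R) (rel I₂) b (AgreeOn-narrow ≤-refl b≤m highAgree)

  icDown-decomposition : 1 ≤ n → 1 ≤ m → icDownR (n + m) R ≡ icDown I₂ ++ icR R (suc n) ∷ icDown I₁
  icDown-decomposition 1≤n 1≤m = ≡-trans (icDownR-split n m R 1≤n 1≤m) (cong₂ _++_
    (map-cong-local (All.map (λ {b} (2≤b , b≤m) → upper-ic b 2≤b b≤m) (down2-bounds m)))
    (cong (icR R (suc n) ∷_) (icDownR-local n R (rel I₁) lowAgree)))

filterB-All : ∀ {P : ℕ → Set} p xs → All P xs → All P (filterB p xs)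
filterB-All p []       []         = []
filterB-All p (x ∷ xs) (px ∷ pxs) with p x
... | true  = px ∷ filterB-All p xs pxs
... | false = filterB-All p xs pxs

memB-All : ∀ {P : ℕ → Set} x xs → All P xs → memB x xs ≡ true → P x
memB-All {P} x (y ∷ ys) (py ∷ pys) e with ∨-elim (y ≡ᵇ x) e
... | inj₁ y≡x  = subst P (≡ᵇ⇒≡ y x (toT y≡x)) py
... | inj₂ rest = memB-All x ys pys rest

decRoots-bounds : ∀ {m} (I : IntervalPoset m) → All (λ y → 1 ≤ y × y ≤ m) (decRoots I)
decRoots-bounds {m} I = filterB-All _ (range1 m) (range1-All m (λ y 1≤y y≤m → 1≤y , y≤m))

module Graft {n m} (I₁ : IntervalPoset n) (I₂ : IntervalPoset m) where

  SC : BRel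
  SC = shiftConcat I₁ I₂

  SC-low : ∀ {x y} → rel I₁ x y ≡ true → SC x y ≡ true
  SC-low = ∨-introˡ _

  SC-high : ∀ {x y} → n < x → n < y → rel I₂ (x ∸ n) (y ∸ n) ≡ true → SC x y ≡ true
  SC-high {x} n<x n<y r = ∨-introʳ (rel I₁ x _) (∧-intro (fromT (<⇒<ᵇ n<x)) (∧-intro (fromT (<⇒<ᵇ n<y)) r))

  data View (Extra : ℕ → ℕ → Set) (x y : ℕ) : Set where
    low   : rel I₁ x y ≡ true → View Extra x y
    high  : n < x → n < y → rel I₂ (x ∸ n) (y ∸ n) ≡ true → View Extra x y
    extra : Extra x y → View Extra x y

  SC-view : ∀ {Extra} x y → SC x y ≡ true → View Extra x y
  SC-view x y e with ∨-elim (rel I₁ x y) e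
  ... | inj₁ r = low r
  ... | inj₂ h with ∧-elim (n <ᵇ x) h
  ... | n<x , h′ with ∧-elim (n <ᵇ y) h′
  ... | n<y , r = high (<ᵇ⇒< n x (toT n<x)) (<ᵇ⇒< n y (toT n<y)) r

  Crossing : (ℕ → ℕ → Set) → Set
  Crossing Extra = ∀ {x y} → Extra x y → (x ≤ n × n < y) ⊎ (n < x × y ≤ n)

  module Restriction (R : BRel) {Extra : ℕ → ℕ → Set}
    (extends : ∀ x y → SC x y ≡ true → R x y ≡ true)
    (view : ∀ x y → R x y ≡ true → View Extra x y)
    (crossing : Crossing Extra) where

    restrict-low : ∀ x y → x ≤ n → y ≤ n → R x y ≡ rel I₁ x y
    restrict-low x y x≤n y≤n = ≡true-ext to (extends x y ∘ SC-low)
      where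
      to : R x y ≡ true → rel I₁ x y ≡ true
      to e with view x y e
      ... | low r        = r
      ... | high n<x _ _ = ⊥-elim (<⇒≱ n<x x≤n)
      ... | extra ex with crossing ex
      ... | inj₁ (_ , n<y) = ⊥-elim (<⇒≱ n<y y≤n)
      ... | inj₂ (n<x , _) = ⊥-elim (<⇒≱ n<x x≤n)

    restrict-high : ∀ x y → 1 ≤ x → 1 ≤ y → R (n + x) (n + y) ≡ rel I₂ x y
    restrict-high x y 1≤x 1≤y = ≡true-ext to from
      where
      n<n+x : n < n + x
      n<n+x = m<m+n n 1≤x
      n<n+y : n < n + y
      n<n+y = m<m+n n 1≤y
      unshift : rel I₂ (n + x ∸ n) (n + y ∸ n) ≡ rel I₂ x y
      unshift = cong₂ (rel I₂) (m+n∸m≡n n x) (m+n∸m≡n n y)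
      to : R (n + x) (n + y) ≡ true → rel I₂ x y ≡ true
      to e with view (n + x) (n + y) e
      ... | low r        = ⊥-elim (<⇒≱ n<n+x (proj₁ (proj₂ (support I₁ _ _ r))))
      ... | high _ _ r   = ≡-trans (sym unshift) r
      ... | extra ex with crossing ex
      ... | inj₁ (n+x≤n , _) = ⊥-elim (<⇒≱ n<n+x n+x≤n)
      ... | inj₂ (_ , n+y≤n) = ⊥-elim (<⇒≱ n<n+y n+y≤n)
      from : rel I₂ x y ≡ true → R (n + x) (n + y) ≡ true
      from r = extends (n + x) (n + y) (SC-high n<n+x n<n+y (≡-trans unshift r))

    lowAgree : AgreeOn 1 n R (rel I₁)
    lowAgree x y _ x<y y≤n = restrict-low x y (<⇒≤ (<-≤-trans x<y y≤n)) y≤n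

    highAgree : AgreeOn 1 m (shiftRel n R) (rel I₂)
    highAgree x y 1≤x x<y _ = restrict-high x y 1≤x (≤-trans 1≤x (<⇒≤ x<y))

  baseL : BRel
  baseL x y = SC x y ∨ ((0 <ᵇ m) ∧ (1 ≤ᵇ x) ∧ (x ≤ᵇ n) ∧ (y ≡ᵇ suc n))

  -- In the closure a lower vertex x lies below an upper vertex y only if n+1 ◁ y.
  data Below (x y : ℕ) : Set where
    below : 1 ≤ x → x ≤ n → n < y → rel I₂ 1 (y ∸ n) ≡ true → Below x y

  leftView-trans : ∀ {x y z} → View Below x y → View Below y z → View Below x z
  leftView-trans (low r)       (low r′)                       = low (trans I₁ _ _ _ r r′)
  leftView-trans (low r)       (high n<y _ _)                 = ⊥-elim (<⇒≱ n<y (proj₂ (proj₂ (proj₂ (support I₁ _ _ r)))))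
  leftView-trans (low r)       (extra (below _ _ n<z r′))     =
    extra (below (proj₁ (support I₁ _ _ r)) (proj₁ (proj₂ (support I₁ _ _ r))) n<z r′)
  leftView-trans (high _ n<y _) (low r′)                      = ⊥-elim (<⇒≱ n<y (proj₁ (proj₂ (support I₁ _ _ r′))))
  leftView-trans (high n<x _ r) (high _ n<z r′)               = high n<x n<z (trans I₂ _ _ _ r r′)
  leftView-trans (high _ n<y _) (extra (below _ y≤n _ _))     = ⊥-elim (<⇒≱ n<y y≤n)
  leftView-trans (extra (below _ _ n<y _)) (low r′)           = ⊥-elim (<⇒≱ n<y (proj₁ (proj₂ (support I₁ _ _ r′))))
  leftView-trans (extra (below 1≤x x≤n _ r)) (high _ n<z r′)  = extra (below 1≤x x≤n n<z (trans I₂ _ _ _ r r′))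
  leftView-trans (extra (below _ _ n<y _)) (extra (below _ y≤n _ _)) = ⊥-elim (<⇒≱ n<y y≤n)

  baseL-view : ∀ x y → baseL x y ≡ true → View Below x y
  baseL-view x y e with ∨-elim (SC x y) e
  ... | inj₁ s = SC-view x y s
  ... | inj₂ j with ∧-elim (0 <ᵇ m) j
  ... | 0<m , j₁ with ∧-elim (1 ≤ᵇ x) j₁
  ... | 1≤x , j₂ with ∧-elim (x ≤ᵇ n) j₂
  ... | x≤n , y≡1+n with ≡ᵇ⇒≡ y (suc n) (toT y≡1+n)
  ... | refl = extra (below (≤ᵇ⇒≤ 1 x (toT 1≤x)) (≤ᵇ⇒≤ x n (toT x≤n)) (n<1+n n) junction-is-root)
    where
    junction-is-root : rel I₂ 1 (suc n ∸ n) ≡ true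
    junction-is-root = subst (λ v → rel I₂ 1 v ≡ true) (sym (m+n∸n≡m 1 n)) (reflex I₂ 1 ≤-refl (<ᵇ⇒< 0 m (toT 0<m)))

  module Left where
    R : BRel
    R = graftL I₁ I₂

    view : ∀ x y → R x y ≡ true → View Below x y
    view = closure-induction (n + m) baseL (View Below) baseL-view leftView-trans

    extends : ∀ x y → SC x y ≡ true → R x y ≡ true
    extends x y s = closure-base (n + m) baseL x y (∨-introˡ _ s)

    crossing : Crossing Below
    crossing (below _ x≤n n<y _) = inj₁ (x≤n , n<y)

    open Restriction R extends view crossing public

    below-junction : 1 ≤ m → ∀ x → 1 ≤ x → x ≤ n → R x (suc n) ≡ true
    below-junction 1≤m x 1≤x x≤n = closure-base (n + m) baseL x (suc n) (∨-introʳ (SC x (suc n))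
      (∧-intro (fromT (<⇒<ᵇ 1≤m)) (∧-intro (fromT (≤⇒≤ᵇ 1≤x)) (∧-intro (fromT (≤⇒≤ᵇ x≤n)) (fromT (≡⇒≡ᵇ (suc n) (suc n) refl))))))

    through-junction : ∀ x b → x ≤ n → 1 ≤ b → R x (n + b) ≡ true → R (suc n) (n + b) ≡ true
    through-junction x b x≤n 1≤b e with view x (n + b) e
    ... | low r                 = ⊥-elim (<⇒≱ (m<m+n n 1≤b) (proj₂ (proj₂ (proj₂ (support I₁ _ _ r)))))
    ... | high n<x _ _          = ⊥-elim (<⇒≱ n<x x≤n)
    ... | extra (below _ _ n<y r) =
      extends (suc n) (n + b) (SC-high (n<1+n n) n<y (subst (λ v → rel I₂ v (n + b ∸ n) ≡ true) (sym (m+n∸n≡m 1 n)) r))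

    no-lower-roots : 1 ≤ m → countB (isIncRoot (n + m) R) (range1 n) ≡ 0
    no-lower-roots 1≤m = countB-false (range1-All n (λ b 1≤b b≤n →
      cong not (from+-∸-any (R b) b (n + m) (suc n) (s≤s b≤n) n+1≤n+m (below-junction 1≤m b 1≤b b≤n))))
      where
      n+1≤n+m : suc n ≤ n + m
      n+1≤n+m = ≤-trans (≤-reflexive (+-comm 1 n)) (+-monoʳ-≤ n 1≤m)

    no-cross-children : 1 ≤ m → ∀ a b → 1 ≤ a → a ≤ n → 2 ≤ b → b ≤ m → isIncChild R (n + b) a ≡ false
    no-cross-children 1≤m a b 1≤a a≤n 2≤b _ = not-child-unless-related R a (n + b) (λ a◁n+b →
      not-cover R a (suc n) (n + b) (s≤s a≤n) n+1<n+b (below-junction 1≤m a 1≤a a≤n)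
        (through-junction a b a≤n (≤-trans (s≤s z≤n) 2≤b) a◁n+b))
      where
      n+1<n+b : suc n < n + b
      n+1<n+b = ≤-trans (≤-reflexive (+-comm 2 n)) (+-monoʳ-≤ n 2≤b)

    junction-children : 1 ≤ m → icR R (suc n) ≡ icInf I₁
    junction-children 1≤m = countB-cong (range1-All n child-iff-root)
      where
      child-iff-root : ∀ a → 1 ≤ a → a ≤ n → isIncChild R (suc n) a ≡ isIncRoot n (rel I₁) a
      child-iff-root a 1≤a a≤n = cong₂ (λ u v → u ∧ not v) (below-junction 1≤m a 1≤a a≤n)
        (any-cong (from+-∸-All a n (λ c a<c c≤n →
          ≡-trans (cong₂ _∧_ (lowAgree a c 1≤a a<c c≤n) (below-junction 1≤m c (≤-trans 1≤a (<⇒≤ a<c)) c≤n))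
                  (∧-identityʳ (rel I₁ a c)))))

  baseR : ℕ → BRel
  baseR r x y = SC x y ∨ ((0 <ᵇ n) ∧ memB x (take r (map (n +_) (decRoots I₂))) ∧ (y ≡ᵇ n))

  data Above (x y : ℕ) : Set where
    above : n < x → x ≤ n + m → 1 ≤ y → y ≤ n → Above x y

  upper-bound : ∀ {x y} → n < x → rel I₂ (x ∸ n) y ≡ true → x ≤ n + m
  upper-bound {x} n<x r = subst (_≤ n + m) (m+[n∸m]≡n (<⇒≤ n<x)) (+-monoʳ-≤ n (proj₁ (proj₂ (support I₂ _ _ r))))

  rightView-trans : ∀ {x y z} → View Above x y → View Above y z → View Above x z
  rightView-trans (low r)        (low r′)                     = low (trans I₁ _ _ _ r r′)
  rightView-trans (low r)        (high n<y _ _)               = ⊥-elim (<⇒≱ n<y (proj₂ (proj₂ (proj₂ (support I₁ _ _ r)))))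
  rightView-trans (low r)        (extra (above n<y _ _ _))    = ⊥-elim (<⇒≱ n<y (proj₂ (proj₂ (proj₂ (support I₁ _ _ r)))))
  rightView-trans (high _ n<y _) (low r′)                     = ⊥-elim (<⇒≱ n<y (proj₁ (proj₂ (support I₁ _ _ r′))))
  rightView-trans (high n<x _ r) (high _ n<z r′)              = high n<x n<z (trans I₂ _ _ _ r r′)
  rightView-trans (high n<x _ r) (extra (above _ _ 1≤z z≤n′)) = extra (above n<x (upper-bound n<x r) 1≤z z≤n′)
  rightView-trans (extra (above n<x x≤ _ _)) (low r′)         =
    extra (above n<x x≤ (proj₁ (proj₂ (proj₂ (support I₁ _ _ r′)))) (proj₂ (proj₂ (proj₂ (support I₁ _ _ r′)))))
  rightView-trans (extra (above _ _ _ y≤n)) (high n<y _ _)    = ⊥-elim (<⇒≱ n<y y≤n)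
  rightView-trans (extra (above _ _ _ y≤n)) (extra (above n<y _ _ _)) = ⊥-elim (<⇒≱ n<y y≤n)

  shifted-roots-upper : ∀ r → All (λ x → n < x × x ≤ n + m) (take r (map (n +_) (decRoots I₂)))
  shifted-roots-upper r = take⁺ r (map⁺ (All.map (λ (1≤y , y≤m) → m<m+n n 1≤y , +-monoʳ-≤ n y≤m) (decRoots-bounds I₂)))

  baseR-view : ∀ r x y → baseR r x y ≡ true → View Above x y
  baseR-view r x y e with ∨-elim (SC x y) e
  ... | inj₁ s = SC-view x y s
  ... | inj₂ j with ∧-elim (0 <ᵇ n) j
  ... | 0<n , j₁ with ∧-elim (memB x (take r (map (n +_) (decRoots I₂)))) j₁
  ... | root , y≡n with ≡ᵇ⇒≡ y n (toT y≡n) | memB-All x _ (shifted-roots-upper r) root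
  ... | refl | n<x , x≤n+m = extra (above n<x x≤n+m (<ᵇ⇒< 0 n (toT 0<n)) ≤-refl)

  module Right (r : ℕ) where
    R : BRel
    R = graftR I₁ r I₂

    view : ∀ x y → R x y ≡ true → View Above x y
    view = closure-induction (n + m) (baseR r) (View Above) (baseR-view r) rightView-trans

    extends : ∀ x y → SC x y ≡ true → R x y ≡ true
    extends x y s = closure-base (n + m) (baseR r) x y (∨-introˡ _ s)

    crossing : Crossing Above
    crossing (above n<x _ _ y≤n) = inj₂ (n<x , y≤n)

    open Restriction R extends view crossing public

    no-upward : ∀ x y → x ≤ n → n < y → R x y ≡ false
    no-upward x y x≤n n<y = ¬-not upward-impossible
      where
      upward-impossible : R x y ≡ true → ⊥
      upward-impossible e with view x y e
      ... | low r′                   = <⇒≱ n<y (proj₂ (proj₂ (proj₂ (support I₁ _ _ r′))))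
      ... | high n<x _ _             = <⇒≱ n<x x≤n
      ... | extra (above n<x _ _ _)  = <⇒≱ n<x x≤n

    lower-roots : countB (isIncRoot (n + m) R) (range1 n) ≡ icInf I₁
    lower-roots = countB-cong (range1-All n (λ b 1≤b b≤n →
      ≡-trans (isIncRoot-extend n m R b b≤n (λ c n<c → no-upward b c b≤n n<c))
              (isIncRoot-local n R (rel I₁) b (AgreeOn-narrow 1≤b ≤-refl lowAgree))))

    no-cross-children : ∀ a b → 1 ≤ a → a ≤ n → 2 ≤ b → b ≤ m → isIncChild R (n + b) a ≡ false
    no-cross-children a b _ a≤n 2≤b _ =
      not-related-not-child R a (n + b) (no-upward a (n + b) a≤n (m<m+n n (≤-trans (s≤s z≤n) 2≤b)))

    junction-children : icR R (suc n) ≡ 0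
    junction-children = countB-false (range1-All n (λ a _ a≤n →
      not-related-not-child R a (suc n) (no-upward a (suc n) a≤n (n<1+n n))))

graftL-IC : ∀ {n m} (I₁ : IntervalPoset n) (I₂ : IntervalPoset m) → 1 ≤ n → 1 ≤ m →
  (icInfR (n + m) (graftL I₁ I₂) ≡ icInf I₂)
  × (ICR (n + m) (graftL I₁ I₂) ≡ icInf I₂ ∷ icDown I₂ ++ icInf I₁ ∷ icDown I₁)
graftL-IC {n} {m} I₁ I₂ 1≤n 1≤m = icInf-eq , cong₂ _∷_ icInf-eq
  (≡-trans (D.icDown-decomposition 1≤n 1≤m) (cong (λ c → icDown I₂ ++ c ∷ icDown I₁) (junction-children 1≤m)))
  where
  open Graft.Left I₁ I₂
  module D = Decomposition I₁ I₂ R lowAgree highAgree (no-cross-children 1≤m)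
  icInf-eq : icInfR (n + m) R ≡ icInf I₂
  icInf-eq = ≡-trans D.icInf-decomposition (cong (_+ icInf I₂) (no-lower-roots 1≤m))

graftR-IC : ∀ {n m} (I₁ : IntervalPoset n) (I₂ : IntervalPoset m) r → 1 ≤ n → 1 ≤ m →
  (icInfR (n + m) (graftR I₁ r I₂) ≡ icInf I₂ + icInf I₁)
  × (ICR (n + m) (graftR I₁ r I₂) ≡ (icInf I₂ + icInf I₁) ∷ icDown I₂ ++ 0 ∷ icDown I₁)
graftR-IC {n} {m} I₁ I₂ r 1≤n 1≤m = icInf-eq , cong₂ _∷_ icInf-eq
  (≡-trans (D.icDown-decomposition 1≤n 1≤m) (cong (λ c → icDown I₂ ++ c ∷ icDown I₁) junction-children))
  where
  open Graft.Right I₁ I₂ r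
  module D = Decomposition I₁ I₂ R lowAgree highAgree no-cross-children
  icInf-eq : icInfR (n + m) R ≡ icInf I₂ + icInf I₁
  icInf-eq = ≡-trans D.icInf-decomposition (≡-trans (cong (_+ icInf I₂) lower-roots) (+-comm (icInf I₁) (icInf I₂)))

graftL-empty : ∀ {m} (I₁ : IntervalPoset 0) (I₂ : IntervalPoset m) x y → graftL I₁ I₂ x y ≡ rel I₂ x y
graftL-empty I₁ I₂ x y = ≡true-ext to (λ r → extends x y (SC-high (proj₁ (support I₂ x y r)) (proj₁ (proj₂ (proj₂ (support I₂ x y r)))) r))
  where
  open Graft I₁ I₂
  open Left
  to : R x y ≡ true → rel I₂ x y ≡ true
  to e with view x y e
  ... | low r                       = ⊥-elim (<⇒≱ (proj₁ (support I₁ x y r)) (proj₁ (proj₂ (support I₁ x y r))))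
  ... | high _ _ r                  = r
  ... | extra (below 1≤x x≤0 _ _)   = ⊥-elim (<⇒≱ 1≤x x≤0)

graftR-empty : ∀ {n} (I₁ : IntervalPoset n) (I₂ : IntervalPoset 0) r x y → graftR I₁ r I₂ x y ≡ rel I₁ x y
graftR-empty {n} I₁ I₂ r x y = ≡true-ext to (extends x y ∘ SC-low)
  where
  open Graft I₁ I₂
  open Right r
  to : R x y ≡ true → rel I₁ x y ≡ true
  to e with view x y e
  ... | low r′                        = r′
  ... | high _ _ r′                   = ⊥-elim (<⇒≱ (proj₁ (support I₂ _ _ r′)) (proj₁ (proj₂ (support I₂ _ _ r′))))
  ... | extra (above n<x x≤n+0 _ _)   = ⊥-elim (<⇒≱ n<x (subst (x ≤_) (+-identityʳ n) x≤n+0))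

ICR-pointwise : ∀ N R S → (∀ x y → R x y ≡ S x y) → ICR N R ≡ ICR N S
ICR-pointwise N R S R≗S = ICR-local N R S (λ x y _ _ _ → R≗S x y)

proposition4p3 :
    (∀ {n m} (I₁ : IntervalPoset n) (I₂ : IntervalPoset m) → 0 < n → 0 < m →
       (icInfR (n + m) (graftL I₁ I₂) ≡ icInf I₂)
       × (ICR (n + m) (graftL I₁ I₂) ≡ icInf I₂ ∷ icDown I₂ ++ icInf I₁ ∷ icDown I₁)
       × (∀ i → i ≤ length (decRoots I₂) →
            (icInfR (n + m) (graftR I₁ i I₂) ≡ icInf I₂ + icInf I₁)
            × (ICR (n + m) (graftR I₁ i I₂) ≡ (icInf I₂ + icInf I₁) ∷ icDown I₂ ++ 0 ∷ icDown I₁)))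
    × (∀ {m} (I₁ : IntervalPoset 0) (I₂ : IntervalPoset m) → 0 < m →
       (∀ x y → graftL I₁ I₂ x y ≡ rel I₂ x y)
       × (ICR (0 + m) (graftL I₁ I₂) ≡ IC I₂))
    × (∀ {n} (I₁ : IntervalPoset n) (I₂ : IntervalPoset 0) → 0 < n →
       ∀ i → i ≤ length (decRoots I₂) →
       (∀ x y → graftR I₁ i I₂ x y ≡ rel I₁ x y)
       × (ICR (n + 0) (graftR I₁ i I₂) ≡ IC I₁))
proposition4p3 =
  (λ I₁ I₂ 1≤n 1≤m →
    proj₁ (graftL-IC I₁ I₂ 1≤n 1≤m) , proj₂ (graftL-IC I₁ I₂ 1≤n 1≤m) , λ i _ → graftR-IC I₁ I₂ i 1≤n 1≤m) ,
  (λ {m} I₁ I₂ _ → graftL-empty I₁ I₂ , ICR-pointwise m (graftL I₁ I₂) (rel I₂) (graftL-empty I₁ I₂)) ,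
  (λ {n} I₁ I₂ _ i _ → graftR-empty I₁ I₂ i ,
    ≡-trans (cong (λ N → ICR N (graftR I₁ i I₂)) (+-identityʳ n))
            (ICR-pointwise n (graftR I₁ i I₂) (rel I₁) (graftR-empty I₁ I₂ i)))
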